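{- Let $(J_n)_{n\ge 0}$ be the Jacobsthal numbers and, for $n\ge 0$, let $$HSJ_n=\begin{bmatrix} J_n+jJ_{n+3}\\ -J_{n+1}+jJ_{n+2}\end{bmatrix}.$$ Then: (1) for all integers $n\ge 0$ and $t\ge 0$, $\displaystyle\sum_{s=0}^{t} HSJ_{n+s}=\frac12\left(HSJ_{n+t+2}-HSJ_{n+1}\right)$; (2) for all integers $n\ge 1$, $\displaystyle\sum_{s=1}^{n} HSJ_{s}=\frac12\left(HSJ_{n+2}-HSJ_{2}\right)$.
   Context: The Jacobsthal numbers are defined by $J_0=0$, $J_1=1$, $J_{n+2}=J_{n+1}+2J_n$. Here $j$ is the hyperbolic unit ($j^2=1$, $j\neq\pm1$); spinors are column vectors with two hyperbolic-number entries, added and multiplied by real scalars componentwise. -}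

module Defs where

open import Data.Nat as ℕ using (ℕ; zero; suc)
open import Data.Rational using (ℚ; _+_; _*_; -_; _-_; 0ℚ; ½)
import Data.Rational as Q
import Data.Integer as ℤ

J : ℕ → ℕ
J zero = 0
J (suc zero) = 1
J (suc (suc n)) = J (suc n) ℕ.+ 2 ℕ.* J n

Jq : ℕ → ℚ
Jq n = (ℤ.+ J n) Q./ 1

-- Hyperbolic numbers a + j b (j² = 1) with rational components
record Hyp : Set where
  constructor _+j_
  field
    re : ℚ
    hy : ℚ

_+ₕ_ : Hyp → Hyp → Hyp
(a +j b) +ₕ (c +j d) = (a + c) +j (b + d)

_-ₕ_ : Hyp → Hyp → Hyp
(a +j b) -ₕ (c +j d) = (a - c) +j (b - d)

_·ₕ_ : ℚ → Hyp → Hyp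
r ·ₕ (a +j b) = (r * a) +j (r * b)

0ₕ : Hyp
0ₕ = 0ℚ +j 0ℚ

record Spinor : Set where
  constructor [_,_]
  field
    top : Hyp
    bot : Hyp

_+ₛ_ : Spinor → Spinor → Spinor
[ a , b ] +ₛ [ c , d ] = [ a +ₕ c , b +ₕ d ]

_-ₛ_ : Spinor → Spinor → Spinor
[ a , b ] -ₛ [ c , d ] = [ a -ₕ c , b -ₕ d ]

_·ₛ_ : ℚ → Spinor → Spinor
r ·ₛ [ a , b ] = [ r ·ₕ a , r ·ₕ b ]

0ₛ : Spinor
0ₛ = [ 0ₕ , 0ₕ ]

HSJ : ℕ → Spinor
HSJ n = [ Jq n +j Jq (n ℕ.+ 3) , (- Jq (n ℕ.+ 1)) +j Jq (n ℕ.+ 2) ]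

-- Σ_{s=a}^{b} f s  (empty, i.e. 0, when b < a)
ΣS : ℕ → ℕ → (ℕ → Spinor) → Spinor
ΣS a b f = go (suc b ℕ.∸ a)
  where
  go : ℕ → Spinor
  go zero = 0ₛ
  go (suc k) = go k +ₛ f (a ℕ.+ k)

-- Like the Jacobsthal numbers themselves, HSJ satisfies X (m + 2) = X (m + 1) + 2 X m,
-- so 2 X m = X (m + 2) - X (m + 1) and the sum telescopes.  This holds for any
-- spinor sequence with that recurrence; part (2) is part (1) started at n = 1.
module Submission where

open import Defs
open import Data.Nat using (ℕ; _+_; _≥_; zero; suc)
import Data.Nat as ℕ
import Data.Nat.Properties as ℕ
open import Data.Product using (_×_; _,_)
open import Data.Rational as ℚ using (ℚ; ½; 0ℚ; toℚᵘ)
open import Data.Rational.Properties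
  using (toℚᵘ-injective; toℚᵘ-fromℚᵘ; toℚᵘ-homo-+; toℚᵘ-homo-*; neg-distrib-+; neg-distribʳ-*)
open import Data.Rational.Solver using (module +-*-Solver)
open import Data.Rational.Unnormalised as ℚᵘ using (mkℚᵘ; *≡*; _≃_)
open import Data.Rational.Unnormalised.Properties as ℚᵘ using (≃-sym; +-cong; *-cong)
open import Data.Integer as ℤ using (+_)
open import Data.Integer.Properties using (pos-+; pos-*; *-identityʳ)
open import Relation.Binary.PropositionalEquality using (_≡_; refl; cong; cong₂; sym; trans)
open import Relation.Binary.PropositionalEquality.Properties using (module ≡-Reasoning)

toℚ : ℕ → ℚ
toℚ n = (+ n) ℚ./ 1

toℚᵘ-toℚ : ∀ n → toℚᵘ (toℚ n) ≃ mkℚᵘ (+ n) 0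
toℚᵘ-toℚ n = toℚᵘ-fromℚᵘ (mkℚᵘ (+ n) 0)

toℚ-+ : ∀ m n → toℚ (m + n) ≡ toℚ m ℚ.+ toℚ n
toℚ-+ m n = toℚᵘ-injective (begin
  toℚᵘ (toℚ (m + n))               ≈⟨ toℚᵘ-toℚ (m + n) ⟩
  mkℚᵘ (+ (m + n)) 0                ≈⟨ *≡* (cong (ℤ._* + 1) pos-+′) ⟩
  mkℚᵘ (+ m) 0 ℚᵘ.+ mkℚᵘ (+ n) 0    ≈⟨ +-cong (≃-sym (toℚᵘ-toℚ m)) (≃-sym (toℚᵘ-toℚ n)) ⟩
  toℚᵘ (toℚ m) ℚᵘ.+ toℚᵘ (toℚ n)    ≈⟨ ≃-sym (toℚᵘ-homo-+ (toℚ m) (toℚ n)) ⟩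
  toℚᵘ (toℚ m ℚ.+ toℚ n)            ∎)
  where
  open ℚᵘ.≃-Reasoning
  pos-+′ : + (m + n) ≡ + m ℤ.* + 1 ℤ.+ + n ℤ.* + 1
  pos-+′ = trans (pos-+ m n) (sym (cong₂ ℤ._+_ (*-identityʳ (+ m)) (*-identityʳ (+ n))))

toℚ-* : ∀ m n → toℚ (m ℕ.* n) ≡ toℚ m ℚ.* toℚ n
toℚ-* m n = toℚᵘ-injective (begin
  toℚᵘ (toℚ (m ℕ.* n))              ≈⟨ toℚᵘ-toℚ (m ℕ.* n) ⟩
  mkℚᵘ (+ (m ℕ.* n)) 0              ≈⟨ *≡* (cong (ℤ._* + 1) (pos-* m n)) ⟩
  mkℚᵘ (+ m) 0 ℚᵘ.* mkℚᵘ (+ n) 0    ≈⟨ *-cong (≃-sym (toℚᵘ-toℚ m)) (≃-sym (toℚᵘ-toℚ n)) ⟩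
  toℚᵘ (toℚ m) ℚᵘ.* toℚᵘ (toℚ n)    ≈⟨ ≃-sym (toℚᵘ-homo-* (toℚ m) (toℚ n)) ⟩
  toℚᵘ (toℚ m ℚ.* toℚ n)            ∎)
  where open ℚᵘ.≃-Reasoning

-- Jq n is definitionally toℚ (J n), so the recurrence of J transfers along toℚ-+ and toℚ-*.
Jq-rec : ∀ n → Jq (2 + n) ≡ Jq (1 + n) ℚ.+ toℚ 2 ℚ.* Jq n
Jq-rec n = trans (toℚ-+ (J (1 + n)) (2 ℕ.* J n)) (cong (Jq (1 + n) ℚ.+_) (toℚ-* 2 (J n)))

Jq-rec-at : ∀ {a b c} → a ≡ 2 + c → b ≡ 1 + c → Jq a ≡ Jq b ℚ.+ toℚ 2 ℚ.* Jq c
Jq-rec-at {c = c} refl refl = Jq-rec c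

HSJ-rec : ∀ m → HSJ (m + 2) ≡ HSJ (m + 1) +ₛ (toℚ 2 ·ₛ HSJ m)
HSJ-rec m = cong₂ [_,_]
  (cong₂ _+j_ (Jq-rec-at (ℕ.+-comm m 2) (ℕ.+-comm m 1)) (Jq-rec-at (shift 2 3) (shift 1 3)))
  (cong₂ _+j_ (trans (cong ℚ.-_ (Jq-rec-at (shift 2 1) (shift 1 1))) (neg-rec (Jq (m + 1 + 1)) (Jq (m + 1))))
              (Jq-rec-at (shift 2 2) (shift 1 2)))
  where
  shift : ∀ j k → m + j + k ≡ j + (m + k)
  shift j k = trans (cong (_+ k) (ℕ.+-comm m j)) (ℕ.+-assoc j m k)
  neg-rec : ∀ a b → ℚ.- (a ℚ.+ toℚ 2 ℚ.* b) ≡ ℚ.- a ℚ.+ toℚ 2 ℚ.* ℚ.- b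
  neg-rec a b = trans (neg-distrib-+ a _) (cong (ℚ.- a ℚ.+_) (neg-distribʳ-* (toℚ 2) b))

module _ where
  open +-*-Solver

  ½[y-c]+x : ∀ x y c → ½ ℚ.* (y ℚ.- c) ℚ.+ x ≡ ½ ℚ.* ((y ℚ.+ toℚ 2 ℚ.* x) ℚ.- c)
  ½[y-c]+x = solve 3 (λ x y c → con ½ :* (y :- c) :+ x := con ½ :* ((y :+ con (toℚ 2) :* x) :- c)) refl

  ½[y-y]≡0 : ∀ y → ½ ℚ.* (y ℚ.- y) ≡ 0ℚ
  ½[y-y]≡0 = solve 1 (λ y → con ½ :* (y :- y) := con 0ℚ) refl

½[Y-C]+ₕX : ∀ X Y C → (½ ·ₕ (Y -ₕ C)) +ₕ X ≡ ½ ·ₕ ((Y +ₕ (toℚ 2 ·ₕ X)) -ₕ C)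
½[Y-C]+ₕX (x₁ +j x₂) (y₁ +j y₂) (c₁ +j c₂) = cong₂ _+j_ (½[y-c]+x x₁ y₁ c₁) (½[y-c]+x x₂ y₂ c₂)

½[Y-C]+ₛX : ∀ X Y C → (½ ·ₛ (Y -ₛ C)) +ₛ X ≡ ½ ·ₛ ((Y +ₛ (toℚ 2 ·ₛ X)) -ₛ C)
½[Y-C]+ₛX [ x₁ , x₂ ] [ y₁ , y₂ ] [ c₁ , c₂ ] = cong₂ [_,_] (½[Y-C]+ₕX x₁ y₁ c₁) (½[Y-C]+ₕX x₂ y₂ c₂)

½[Y-Y]≡0ₛ : ∀ Y → ½ ·ₛ (Y -ₛ Y) ≡ 0ₛ
½[Y-Y]≡0ₛ [ a +j b , c +j d ] =
  cong₂ [_,_] (cong₂ _+j_ (½[y-y]≡0 a) (½[y-y]≡0 b)) (cong₂ _+j_ (½[y-y]≡0 c) (½[y-y]≡0 d))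

suc[n+t]∸n≡suc[t] : ∀ n t → suc (n + t) ℕ.∸ n ≡ suc t
suc[n+t]∸n≡suc[t] n t = trans (cong (ℕ._∸ n) (sym (ℕ.+-suc n t))) (ℕ.m+n∸m≡n n (suc t))

ΣS-+0 : ∀ n f → ΣS n (n + 0) f ≡ 0ₛ +ₛ f (n + 0)
ΣS-+0 n f rewrite suc[n+t]∸n≡suc[t] n 0 = refl

ΣS-+suc : ∀ n t f → ΣS n (n + suc t) f ≡ ΣS n (n + t) f +ₛ f (n + suc t)
ΣS-+suc n t f rewrite suc[n+t]∸n≡suc[t] n (suc t) | suc[n+t]∸n≡suc[t] n t = refl

module Telescoping (X : ℕ → Spinor) (rec : ∀ m → X (m + 2) ≡ X (m + 1) +ₛ (toℚ 2 ·ₛ X m)) where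
  open ≡-Reasoning

  rec-at : ∀ {b c} → c + 1 ≡ b → X b +ₛ (toℚ 2 ·ₛ X c) ≡ X (c + 2)
  rec-at {c = c} refl = sym (rec c)

  ΣS-telescope : ∀ n t → ΣS n (n + t) X ≡ ½ ·ₛ (X (n + t + 2) -ₛ X (n + 1))
  ΣS-telescope n zero = begin
    ΣS n (n + 0) X                                          ≡⟨ ΣS-+0 n X ⟩
    0ₛ +ₛ X (n + 0)                                         ≡⟨ cong (_+ₛ X (n + 0)) (sym (½[Y-Y]≡0ₛ (X (n + 1)))) ⟩
    (½ ·ₛ (X (n + 1) -ₛ X (n + 1))) +ₛ X (n + 0)            ≡⟨ ½[Y-C]+ₛX (X (n + 0)) (X (n + 1)) (X (n + 1)) ⟩
    ½ ·ₛ ((X (n + 1) +ₛ (toℚ 2 ·ₛ X (n + 0))) -ₛ X (n + 1)) ≡⟨ cong (λ Y → ½ ·ₛ (Y -ₛ X (n + 1))) (rec-at index) ⟩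
    ½ ·ₛ (X (n + 0 + 2) -ₛ X (n + 1))                       ∎
    where
    index : n + 0 + 1 ≡ n + 1
    index = cong (_+ 1) (ℕ.+-identityʳ n)
  ΣS-telescope n (suc t) = begin
    ΣS n (n + suc t) X                                              ≡⟨ ΣS-+suc n t X ⟩
    ΣS n (n + t) X +ₛ X (n + suc t)                                 ≡⟨ cong (_+ₛ X (n + suc t)) (ΣS-telescope n t) ⟩
    (½ ·ₛ (X (n + t + 2) -ₛ X (n + 1))) +ₛ X (n + suc t)            ≡⟨ ½[Y-C]+ₛX (X (n + suc t)) (X (n + t + 2)) (X (n + 1)) ⟩
    ½ ·ₛ ((X (n + t + 2) +ₛ (toℚ 2 ·ₛ X (n + suc t))) -ₛ X (n + 1)) ≡⟨ cong (λ Y → ½ ·ₛ (Y -ₛ X (n + 1))) (rec-at index) ⟩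
    ½ ·ₛ (X (n + suc t + 2) -ₛ X (n + 1))                           ∎
    where
    index : n + suc t + 1 ≡ n + t + 2
    index = trans (cong (_+ 1) (ℕ.+-suc n t)) (sym (ℕ.+-suc (n + t) 1))

open Telescoping HSJ HSJ-rec using (ΣS-telescope)

theorem3p4 : ((n t : ℕ) → ΣS n (n + t) HSJ ≡ ½ ·ₛ (HSJ (n + t + 2) -ₛ HSJ (n + 1)))
    × ((n : ℕ) → n ≥ 1 → ΣS 1 n HSJ ≡ ½ ·ₛ (HSJ (n + 2) -ₛ HSJ 2))
theorem3p4 = ΣS-telescope , λ { (suc k) _ → ΣS-telescope 1 k }
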